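{- Let $\Lambda$ be the cross section lattice of a $J$-irreducible monoid of type $A_n$, $B_n$ or $C_n$, with $\Delta$, $\phi$, $J_0$ as in the context. Suppose that every connected component of $J_0$ is either a singleton $\{\alpha_i\}$, or a connected subset $\widetilde{J_0}\subseteq J_0$ with $|\widetilde{J_0}|>1$ that contains an end-node of $\Delta$. Let $e\in\Lambda$ be such that $\Delta\setminus J_0\subseteq\phi(e)$. Then $e$ is both a right modular and a left modular element of $\Lambda$.
   Context: Let $K$ be an algebraically closed field, $G_0$ a simple algebraic group of type $A_n$, $B_n$ or $C_n$, $\rho:G_0\to GL(V)$ an irreducible rational representation, $G=K^*\cdot\rho(G_0)$, $M=\overline{G}\subseteq\mathrm{End}(V)$ its Zariski closure. A cross section lattice is a finite set $\Lambda$ of idempotents of $M$ meeting every $G\times G$-orbit in exactly one element, ordered by $e\le f\iff e=ef=fe$; it is a lattice with least element $0$ and unique minimal nonzero element $e_0$. Let $T=C_G(\Lambda)$, $B=\{g\in G:ge=ege\ \forall e\in\Lambda\}$, $\Delta$ the simple roots of $T$ relative to $B$, $\sigma_\alpha$ the simple reflections, $\phi(e)=\{\alpha\in\Delta:\sigma_\alpha e=e\sigma_\alpha\ne e\}$, $J_0=\{\alpha\in\Delta:\sigma_\alpha e_0=e_0\sigma_\alpha\}$. Two simple roots $\alpha\ne\beta$ are adjacent iff $\sigma_\alpha\sigma_\beta\ne\sigma_\beta\sigma_\alpha$; connected subsets and connected components refer to this graph (the Dynkin diagram). A simple root $\alpha$ is an end-node if there is a unique $\alpha'\in\Delta$ adjacent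 to it. By Putcha–Renner, $\phi|_{\Lambda\setminus\{0\}}$ is an order isomorphism onto the family of $I\subseteq\Delta$ (ordered by inclusion) no connected component of which lies entirely in $J_0$. In a lattice $L$, $b$ is right modular if $c\vee(a\wedge b)=(c\vee a)\wedge b$ for all $a,c\in L$ with $c\le b$; $a$ is left modular if the same identity holds for all $b,c\in L$ with $c\le b$. -}

module Defs where

open import Data.Nat using (ℕ; suc; _≤_)
open import Data.Fin using (Fin; toℕ)
open import Data.Fin.Subset using (Subset; _∈_; _∉_; _⊆_; ⊥)
open import Data.Product using (Σ; ∃; _×_; _,_)
open import Data.Sum using (_⊎_)
open import Data.Empty using () renaming (⊥ to Empty)
open import Relation.Binary.PropositionalEquality using (_≡_; _≢_)

-- Dynkin diagram of type A_n, B_n, C_n: the path α₀ — α₁ — … — α_{n-1}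
-- (simple roots indexed by Fin n; adjacency ignores bond multiplicity).

Adj : ∀ {n} → Fin n → Fin n → Set
Adj i j = (toℕ i ≡ suc (toℕ j)) ⊎ (toℕ j ≡ suc (toℕ i))

EndNode : ∀ {n} → Fin n → Set
EndNode {n} i = Σ (Fin n) λ a → Adj i a × (∀ b → Adj i b → b ≡ a)

Between : ∀ {n} → Fin n → Fin n → Fin n → Set
Between i j k = (toℕ i ≤ toℕ k × toℕ k ≤ toℕ j) ⊎ (toℕ j ≤ toℕ k × toℕ k ≤ toℕ i)

-- SameComp J i j : j lies in the connected component of i in the subset J
-- (on a path, this means every node between i and j, inclusive, is in J).
SameComp : ∀ {n} → Subset n → Fin n → Fin n → Set
SameComp J i j = ∀ k → Between i j k → k ∈ J

-- No connected component of I lies entirely in J₀.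
Admissible : ∀ {n} → Subset n → Subset n → Set
Admissible {n} J₀ I = ∀ i → i ∈ I → Σ (Fin n) λ j → SameComp I i j × j ∉ J₀

CompHyp : ∀ {n} → Subset n → Set
CompHyp {n} J₀ = ∀ i → i ∈ J₀ →
  (∀ j → SameComp J₀ i j → j ≡ i)
  ⊎ ((Σ (Fin n) λ j → SameComp J₀ i j × j ≢ i)
     × (Σ (Fin n) λ j → SameComp J₀ i j × EndNode j))

-- The cross section lattice Λ, via the Putcha–Renner isomorphism:
-- Λ = {0} ∪ Λ∖{0}, and φ : Λ∖{0} ≅ {I ⊆ Δ admissible} (by inclusion).

data Λ {n} (J₀ : Subset n) : Set where
  zero : Λ J₀
  elt  : (I : Subset n) → Admissible J₀ I → Λ J₀

-- φ(e); φ(0) = ∅ since σ_α 0 = 0 σ_α = 0.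
φ : ∀ {n} {J₀ : Subset n} → Λ J₀ → Subset n
φ zero      = ⊥
φ (elt I _) = I

data _≤Λ_ {n} {J₀ : Subset n} : Λ J₀ → Λ J₀ → Set where
  z≤ : ∀ {x} → zero ≤Λ x
  ⊆≤ : ∀ {I J p q} → I ⊆ J → elt I p ≤Λ elt J q

-- Generic lattice notions for a preorder-presented lattice
-- (equality of elements = mutual ≤; meets/joins = glb/lub).

module LatticeNotions {A : Set} (_≤_ : A → A → Set) where

  _≈_ : A → A → Set
  x ≈ y = x ≤ y × y ≤ x

  IsMeet : A → A → A → Set
  IsMeet a b m = m ≤ a × m ≤ b × (∀ z → z ≤ a → z ≤ b → z ≤ m)

  IsJoin : A → A → A → Set
  IsJoin a b j = a ≤ j × b ≤ j × (∀ z → a ≤ z → b ≤ z → j ≤ z)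

  ModId : A → A → A → Set
  ModId a b c = ∀ m j k l → IsMeet a b m → IsJoin c m j
                → IsJoin c a k → IsMeet k b l → j ≈ l

  RightModular : A → Set
  RightModular b = ∀ a c → c ≤ b → ModId a b c

  LeftModular : A → Set
  LeftModular a = ∀ b c → c ≤ b → ModId a b c

-- The join of Λ is union of index sets.  Meets are the subtle part: in
-- general the meet of I and J is only the largest admissible subset of
-- I ∩ J.  If E contains every root outside J₀, however, E ∩ B is already
-- admissible for every admissible B.  Take i ∈ (E ∩ B) ∩ J₀ and roots
-- jE, jB ∉ J₀ with [i, jE] ⊆ E and [i, jB] ⊆ B.  If they lie on the same
-- side of i, the nearer one, j, satisfies [i, j] ⊆ E ∩ B.  Otherwise the
-- J₀-component of i is enclosed by jE and jB, so it contains no end-node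
-- and by hypothesis is {i}; the neighbour t of i towards jB is then outside
-- J₀, hence in E, and [i, t] = {i, t} ⊆ E ∩ B.  With meets against such
-- elements computed as intersections, both modular identities for e
-- reduce to the modular law of the Boolean lattice of subsets.

module Submission where

open import Defs
open import Data.Nat using (ℕ; _≤_)
open import Data.Fin using (Fin)
open import Data.Fin.Subset using (Subset; _∈_; _∉_)
open import Data.Product using (∃; _×_)

open import Data.Nat.Base using (suc; _<_; z≤n)
open import Data.Nat.Properties
  using (≤-trans; ≤-antisym; ≤-total; _≤?_; ≰⇒>; <-cmp; ≤-<-trans;
         n≤1+n; m≤n⇒m<n∨m≡n; m<1+n⇒m≤n; 1+n≢n; 1+n≰n; m≢1+n+m)
open import Data.Fin.Base using (toℕ; fromℕ<; inject₁; suc)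
open import Data.Fin.Properties using (toℕ-injective; toℕ-fromℕ<; toℕ-inject₁; toℕ<n)
open import Data.Fin.Subset using (_∩_; _∪_; _⊆_)
open import Data.Fin.Subset.Properties
  using (x∈p∩q⁺; x∈p∩q⁻; x∈p∪q⁺; x∈p∪q⁻; p∩q⊆p; p∩q⊆q; p⊆p∪q; q⊆p∪q; ∉⊥; _∈?_;
         ⊆-antisym; ⊆-reflexive; ∩-comm; ∪-distribˡ-∩)
open import Data.Product using (Σ; _,_)
open import Data.Sum using (_⊎_; inj₁; inj₂; [_,_]; swap; map)
open import Data.Empty using (⊥-elim)
open import Function using (_∘_; id)
open import Relation.Nullary using (¬_; yes; no)
open import Relation.Binary.PropositionalEquality
  using (_≡_; _≢_; refl; sym; trans; cong; subst; module ≡-Reasoning)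
open import Relation.Binary.Definitions using (tri<; tri≈; tri>)

≤-≤1+⇒≡⊎≡1+ : ∀ {a x} → a ≤ x → x ≤ suc a → x ≡ a ⊎ x ≡ suc a
≤-≤1+⇒≡⊎≡1+ a≤x x≤1+a with m≤n⇒m<n∨m≡n x≤1+a
... | inj₁ x<1+a = inj₁ (≤-antisym (m<1+n⇒m≤n x<1+a) a≤x)
... | inj₂ x≡1+a = inj₂ x≡1+a

module _ {n : ℕ} where

  between-self : {i k : Fin n} → Between i i k → k ≡ i
  between-self (inj₁ (i≤k , k≤i)) = toℕ-injective (≤-antisym k≤i i≤k)
  between-self (inj₂ (i≤k , k≤i)) = toℕ-injective (≤-antisym k≤i i≤k)

  between-sym : {i j k : Fin n} → Between i j k → Between j i k
  between-sym = swap

  between-shrink : {i j l k : Fin n} → Between i j l → Between i l k → Between i j k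
  between-shrink (inj₁ (i≤l , l≤j)) (inj₁ (i≤k , k≤l)) = inj₁ (i≤k , ≤-trans k≤l l≤j)
  between-shrink (inj₁ (i≤l , l≤j)) (inj₂ (l≤k , k≤i)) =
    inj₁ (≤-trans i≤l l≤k , ≤-trans k≤i (≤-trans i≤l l≤j))
  between-shrink (inj₂ (j≤l , l≤i)) (inj₁ (i≤k , k≤l)) =
    inj₂ (≤-trans j≤l (≤-trans l≤i i≤k) , ≤-trans k≤l l≤i)
  between-shrink (inj₂ (j≤l , l≤i)) (inj₂ (l≤k , k≤i)) = inj₂ (≤-trans j≤l l≤k , k≤i)

  between-trichotomy : (i x y : Fin n) → Between x y i ⊎ Between i x y ⊎ Between i y x
  between-trichotomy i x y
    with ≤-total (toℕ x) (toℕ i) | ≤-total (toℕ y) (toℕ i) | ≤-total (toℕ x) (toℕ y)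
  ... | inj₁ x≤i | inj₁ y≤i | inj₁ x≤y = inj₂ (inj₁ (inj₂ (x≤y , y≤i)))
  ... | inj₁ x≤i | inj₁ y≤i | inj₂ y≤x = inj₂ (inj₂ (inj₂ (y≤x , x≤i)))
  ... | inj₂ i≤x | inj₂ i≤y | inj₁ x≤y = inj₂ (inj₂ (inj₁ (i≤x , x≤y)))
  ... | inj₂ i≤x | inj₂ i≤y | inj₂ y≤x = inj₂ (inj₁ (inj₁ (i≤y , y≤x)))
  ... | inj₁ x≤i | inj₂ i≤y | _        = inj₁ (inj₁ (x≤i , i≤y))
  ... | inj₂ i≤x | inj₁ y≤i | _        = inj₁ (inj₂ (y≤i , i≤x))

  successor : (i : Fin n) → suc (toℕ i) < n → Σ (Fin n) λ t → toℕ t ≡ suc (toℕ i)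
  successor i 1+i<n = fromℕ< 1+i<n , toℕ-fromℕ< 1+i<n

  predecessor : (i : Fin n) → 0 < toℕ i → Σ (Fin n) λ t → toℕ i ≡ suc (toℕ t)
  predecessor (suc i) _ = inject₁ i , cong suc (sym (toℕ-inject₁ i))

  adj⇒≢ : {i t : Fin n} → Adj i t → t ≢ i
  adj⇒≢ (inj₁ i≡1+i) refl = 1+n≢n (sym i≡1+i)
  adj⇒≢ (inj₂ i≡1+i) refl = 1+n≢n (sym i≡1+i)

  between-adj : {i t k : Fin n} → Adj i t → Between i t k → k ≡ i ⊎ k ≡ t
  between-adj (inj₂ t≡1+i) k∈[i,t] = between-successor t≡1+i k∈[i,t]
    where
    between-successor : {i t k : Fin n} → toℕ t ≡ suc (toℕ i) → Between i t k → k ≡ i ⊎ k ≡ t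
    between-successor {i} {t} {k} t≡1+i (inj₁ (i≤k , k≤t)) =
      map toℕ-injective (λ k≡1+i → toℕ-injective (trans k≡1+i (sym t≡1+i)))
          (≤-≤1+⇒≡⊎≡1+ i≤k (subst (toℕ k ≤_) t≡1+i k≤t))
    between-successor {i} t≡1+i (inj₂ (t≤k , k≤i)) =
      ⊥-elim (1+n≰n (subst (_≤ toℕ i) t≡1+i (≤-trans t≤k k≤i)))
  between-adj (inj₁ i≡1+t) k∈[i,t] = swap (between-adj (inj₂ i≡1+t) (between-sym k∈[i,t]))

  step-toward : {i y : Fin n} → i ≢ y → Σ (Fin n) λ t → Adj i t × Between i y t
  step-toward {i} {y} i≢y with <-cmp (toℕ i) (toℕ y)
  ... | tri≈ _ i≡y _ = ⊥-elim (i≢y (toℕ-injective i≡y))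
  ... | tri< i<y _ _ with successor i (≤-<-trans i<y (toℕ<n y))
  ...   | t , t≡1+i =
    t , inj₂ t≡1+i ,
    inj₁ (subst (toℕ i ≤_) (sym t≡1+i) (n≤1+n (toℕ i)) , subst (_≤ toℕ y) (sym t≡1+i) i<y)
  step-toward {i} {y} i≢y | tri> _ _ y<i with predecessor i (≤-<-trans z≤n y<i)
  ...   | t , i≡1+t =
    t , inj₁ i≡1+t ,
    inj₂ (m<1+n⇒m≤n (subst (toℕ y <_) i≡1+t y<i) , subst (toℕ t ≤_) (sym i≡1+t) (n≤1+n (toℕ t)))

  interior-not-endNode : (j : Fin n) → 0 < toℕ j → suc (toℕ j) < n → ¬ EndNode j
  interior-not-endNode j 0<j 1+j<n (a , _ , unique)
    with predecessor j 0<j | successor j 1+j<n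
  ... | l , j≡1+l | r , r≡1+j = m≢1+n+m (toℕ j) {1} (begin
    toℕ j            ≡⟨ j≡1+l ⟩
    suc (toℕ l)      ≡⟨ cong (suc ∘ toℕ) l≡r ⟩
    suc (toℕ r)      ≡⟨ cong suc r≡1+j ⟩
    suc (suc (toℕ j)) ∎)
    where
    open ≡-Reasoning
    l≡r : l ≡ r
    l≡r = trans (unique l (inj₁ j≡1+l)) (sym (unique r (inj₂ r≡1+j)))

  module _ {A : Subset n} where

    sameComp-self : {i : Fin n} → i ∈ A → SameComp A i i
    sameComp-self i∈A k k∈[i,i] = subst (_∈ A) (sym (between-self k∈[i,i])) i∈A

    sameComp-shrink : {i j l : Fin n} → SameComp A i j → Between i j l → SameComp A i l
    sameComp-shrink [i,j]⊆A l∈[i,j] k k∈[i,l] = [i,j]⊆A k (between-shrink l∈[i,j] k∈[i,l])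

    sameComp-mono : {B : Subset n} {i j : Fin n} → A ⊆ B → SameComp A i j → SameComp B i j
    sameComp-mono A⊆B [i,j]⊆A k k∈[i,j] = A⊆B ([i,j]⊆A k k∈[i,j])

    sameComp-∩ : {B : Subset n} {i j : Fin n} → SameComp A i j → SameComp B i j → SameComp (A ∩ B) i j
    sameComp-∩ [i,j]⊆A [i,j]⊆B k k∈[i,j] = x∈p∩q⁺ ([i,j]⊆A k k∈[i,j] , [i,j]⊆B k k∈[i,j])

    sameComp-adj : {i t : Fin n} → i ∈ A → t ∈ A → Adj i t → SameComp A i t
    sameComp-adj i∈A t∈A adj k k∈[i,t] with between-adj adj k∈[i,t]
    ... | inj₁ refl = i∈A
    ... | inj₂ refl = t∈A

    enclosed-not-endNode : {x y i j : Fin n} → x ∉ A → y ∉ A → Between x y i → SameComp A i j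
                         → ¬ EndNode j
    enclosed-not-endNode x∉A y∉A (inj₁ (x≤i , i≤y)) = bounded x∉A y∉A x≤i i≤y
      where
      bounded : {x y i j : Fin n} → x ∉ A → y ∉ A → toℕ x ≤ toℕ i → toℕ i ≤ toℕ y
              → SameComp A i j → ¬ EndNode j
      bounded {x} {y} {i} {j} x∉A y∉A x≤i i≤y [i,j]⊆A with toℕ j ≤? toℕ x | toℕ y ≤? toℕ j
      ... | yes j≤x | _       = ⊥-elim (x∉A ([i,j]⊆A x (inj₂ (j≤x , x≤i))))
      ... | no _    | yes y≤j = ⊥-elim (y∉A ([i,j]⊆A y (inj₁ (i≤y , y≤j))))
      ... | no j≰x  | no y≰j  =
        interior-not-endNode j (≤-<-trans z≤n (≰⇒> j≰x)) (≤-<-trans (≰⇒> y≰j) (toℕ<n y))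
    enclosed-not-endNode x∉A y∉A (inj₂ i∈[y,x]) =
      enclosed-not-endNode y∉A x∉A (inj₁ i∈[y,x])

p⊆q⇒p∩q≡p : {n : ℕ} {p q : Subset n} → p ⊆ q → p ∩ q ≡ p
p⊆q⇒p∩q≡p {p = p} {q} p⊆q = ⊆-antisym (p∩q⊆p p q) (λ x∈p → x∈p∩q⁺ (x∈p , p⊆q x∈p))

p⊆q⇒p∪q≡q : {n : ℕ} {p q : Subset n} → p ⊆ q → p ∪ q ≡ q
p⊆q⇒p∪q≡q {p = p} {q} p⊆q =
  ⊆-antisym (λ {x} x∈p∪q → [ p⊆q , id ] (x∈p∪q⁻ p q x∈p∪q)) (q⊆p∪q p q)

p⊆r⇒p∪[q∩r]≡[p∪q]∩r : {n : ℕ} {p q r : Subset n} → p ⊆ r → p ∪ (q ∩ r) ≡ (p ∪ q) ∩ r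
p⊆r⇒p∪[q∩r]≡[p∪q]∩r {p = p} {q} {r} p⊆r = begin
  p ∪ (q ∩ r)       ≡⟨ ∪-distribˡ-∩ p q r ⟩
  (p ∪ q) ∩ (p ∪ r) ≡⟨ cong ((p ∪ q) ∩_) (p⊆q⇒p∪q≡q p⊆r) ⟩
  (p ∪ q) ∩ r       ∎
  where open ≡-Reasoning

module _ {n : ℕ} (J₀ : Subset n) where

  Covering : Subset n → Set
  Covering E = ∀ α → α ∉ J₀ → α ∈ E

  ∪-admissible : {A B : Subset n} → Admissible J₀ A → Admissible J₀ B → Admissible J₀ (A ∪ B)
  ∪-admissible {A} {B} admA admB i i∈A∪B with x∈p∪q⁻ A B i∈A∪B
  ... | inj₁ i∈A with admA i i∈A
  ...   | j , [i,j]⊆A , j∉J₀ = j , sameComp-mono (p⊆p∪q B) [i,j]⊆A , j∉J₀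
  ∪-admissible {A} {B} admA admB i i∈A∪B | inj₂ i∈B with admB i i∈B
  ...   | j , [i,j]⊆B , j∉J₀ = j , sameComp-mono (q⊆p∪q A B) [i,j]⊆B , j∉J₀

  enclosed-isolated : CompHyp J₀ → {x y i : Fin n} → i ∈ J₀ → x ∉ J₀ → y ∉ J₀
                    → Between x y i → ∀ j → SameComp J₀ i j → j ≡ i
  enclosed-isolated compHyp i∈J₀ x∉J₀ y∉J₀ i∈[x,y] with compHyp _ i∈J₀
  ... | inj₁ isolated = isolated
  ... | inj₂ (_ , j , [i,j]⊆J₀ , endNode) =
    ⊥-elim (enclosed-not-endNode x∉J₀ y∉J₀ i∈[x,y] [i,j]⊆J₀ endNode)

  isolated-adj∉ : {i t : Fin n} → (∀ j → SameComp J₀ i j → j ≡ i) → i ∈ J₀ → Adj i t → t ∉ J₀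
  isolated-adj∉ isolated i∈J₀ adj t∈J₀ = adj⇒≢ adj (isolated _ (sameComp-adj i∈J₀ t∈J₀ adj))

  ∩-admissible : CompHyp J₀ → {E B : Subset n} → Admissible J₀ E → Covering E → Admissible J₀ B
               → Admissible J₀ (E ∩ B)
  ∩-admissible compHyp {E} {B} admE covE admB i i∈E∩B with x∈p∩q⁻ E B i∈E∩B | i ∈? J₀
  ... | _ | no i∉J₀ = i , sameComp-self i∈E∩B , i∉J₀
  ... | i∈E , i∈B | yes i∈J₀ with admE i i∈E | admB i i∈B
  ... | jE , [i,jE]⊆E , jE∉J₀ | jB , [i,jB]⊆B , jB∉J₀ with between-trichotomy i jE jB
  ...   | inj₂ (inj₁ jB∈[i,jE]) =
    jB , sameComp-∩ (sameComp-shrink [i,jE]⊆E jB∈[i,jE]) [i,jB]⊆B , jB∉J₀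
  ...   | inj₂ (inj₂ jE∈[i,jB]) =
    jE , sameComp-∩ [i,jE]⊆E (sameComp-shrink [i,jB]⊆B jE∈[i,jB]) , jE∉J₀
  ...   | inj₁ i∈[jE,jB] with step-toward {i = i} {y = jB} (λ { refl → jB∉J₀ i∈J₀ })
  ...     | t , adj , t∈[i,jB] =
    t , sameComp-adj i∈E∩B (x∈p∩q⁺ (covE t t∉J₀ , [i,jB]⊆B t t∈[i,jB])) adj , t∉J₀
    where
    t∉J₀ : t ∉ J₀
    t∉J₀ = isolated-adj∉ (enclosed-isolated compHyp i∈J₀ jE∉J₀ jB∉J₀ i∈[jE,jB]) i∈J₀ adj

module ModIdFromWitnesses {A : Set} (_≤_ : A → A → Set)
  (≤-refl : ∀ {x} → x ≤ x) (≤-trans : ∀ {x y z} → x ≤ y → y ≤ z → x ≤ z) where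

  open LatticeNotions _≤_

  ≈-refl : ∀ {x} → x ≈ x
  ≈-refl = ≤-refl , ≤-refl

  ≈-trans : ∀ {x y z} → x ≈ y → y ≈ z → x ≈ z
  ≈-trans (x≤y , y≤x) (y≤z , z≤y) = ≤-trans x≤y y≤z , ≤-trans z≤y y≤x

  isMeet-flip : ∀ {a b m} → IsMeet a b m → IsMeet b a m
  isMeet-flip (m≤a , m≤b , glb) = m≤b , m≤a , λ z z≤b z≤a → glb z z≤a z≤b

  isJoin-congʳ : ∀ {x y y' j j'} → y ≈ y' → IsJoin x y j → IsJoin x y' j' → j ≈ j'
  isJoin-congʳ (y≤y' , y'≤y) (x≤j , y≤j , lub) (x≤j' , y'≤j' , lub') =
    lub _ x≤j' (≤-trans y≤y' y'≤j') , lub' _ x≤j (≤-trans y'≤y y≤j)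

  isMeet-congˡ : ∀ {x x' y m m'} → x ≈ x' → IsMeet x y m → IsMeet x' y m' → m ≈ m'
  isMeet-congˡ (x≤x' , x'≤x) (m≤x , m≤y , glb) (m'≤x' , m'≤y , glb') =
    glb' _ (≤-trans m≤x x≤x') m≤y , glb _ (≤-trans m'≤x' x'≤x) m'≤y

  modId-from-witnesses : ∀ {a b c m₀ j₀ k₀ l₀} → IsMeet a b m₀ → IsJoin c m₀ j₀
                       → IsJoin c a k₀ → IsMeet k₀ b l₀ → j₀ ≈ l₀ → ModId a b c
  modId-from-witnesses {m₀ = m₀} {k₀ = k₀} isMeet₀ isJoin₀ isJoin₀′ isMeet₀′ j₀≈l₀
                       m j k l isMeet isJoin isJoin′ isMeet′ =
    ≈-trans (isJoin-congʳ m≈m₀ isJoin isJoin₀)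
            (≈-trans j₀≈l₀ (isMeet-congˡ k₀≈k isMeet₀′ isMeet′))
    where
    m≈m₀ : m ≈ m₀
    m≈m₀ = isMeet-congˡ ≈-refl isMeet isMeet₀
    k₀≈k : k₀ ≈ k
    k₀≈k = isJoin-congʳ ≈-refl isJoin₀′ isJoin′

module _ {n : ℕ} {J₀ : Subset n} where

  open LatticeNotions (_≤Λ_ {n} {J₀})

  ≤Λ-refl : {x : Λ J₀} → x ≤Λ x
  ≤Λ-refl {zero}    = z≤
  ≤Λ-refl {elt _ _} = ⊆≤ id

  ≤Λ-trans : {x y z : Λ J₀} → x ≤Λ y → y ≤Λ z → x ≤Λ z
  ≤Λ-trans z≤       _         = z≤
  ≤Λ-trans (⊆≤ I⊆J) (⊆≤ J⊆K) = ⊆≤ (J⊆K ∘ I⊆J)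

  open ModIdFromWitnesses (_≤Λ_ {n} {J₀}) ≤Λ-refl ≤Λ-trans public

  elt-≡ : {I J : Subset n} {p : Admissible J₀ I} {q : Admissible J₀ J} → I ≡ J → elt I p ≈ elt J q
  elt-≡ I≡J = ⊆≤ (⊆-reflexive I≡J) , ⊆≤ (⊆-reflexive (sym I≡J))

  _∨_ : Λ J₀ → Λ J₀ → Λ J₀
  zero    ∨ y       = y
  elt A p ∨ zero    = elt A p
  elt A p ∨ elt B q = elt (A ∪ B) (∪-admissible J₀ p q)

  ∨-isJoin : (x y : Λ J₀) → IsJoin x y (x ∨ y)
  ∨-isJoin zero      y         = z≤ , ≤Λ-refl , λ _ _ y≤z → y≤z
  ∨-isJoin (elt A p) zero      = ≤Λ-refl , z≤ , λ _ x≤z _ → x≤z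
  ∨-isJoin (elt A p) (elt B q) = ⊆≤ (p⊆p∪q B) , ⊆≤ (q⊆p∪q A B) , lub
    where
    lub : ∀ z → elt A p ≤Λ z → elt B q ≤Λ z → elt (A ∪ B) (∪-admissible J₀ p q) ≤Λ z
    lub _ (⊆≤ A⊆C) (⊆≤ B⊆C) = ⊆≤ (λ {x} x∈A∪B → [ A⊆C , B⊆C ] (x∈p∪q⁻ A B x∈A∪B))

  ∨-coveringʳ : (x : Λ J₀) {y : Λ J₀} → Covering J₀ (φ y) → Covering J₀ (φ (x ∨ y))
  ∨-coveringʳ zero                covY           = covY
  ∨-coveringʳ (elt A p) {zero}    covY α α∉J₀ = ⊥-elim (∉⊥ (covY α α∉J₀))
  ∨-coveringʳ (elt A p) {elt B q} covY α α∉J₀ = q⊆p∪q A B (covY α α∉J₀)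

module _ {n : ℕ} {J₀ : Subset n} (compHyp : CompHyp J₀) where

  open LatticeNotions (_≤Λ_ {n} {J₀})

  _∧⟨_⟩_ : (x : Λ J₀) → Covering J₀ (φ x) → Λ J₀ → Λ J₀
  zero    ∧⟨ _ ⟩    _       = zero
  elt E p ∧⟨ _ ⟩    zero    = zero
  elt E p ∧⟨ covE ⟩ elt B q = elt (E ∩ B) (∩-admissible J₀ compHyp p covE q)

  ∧-isMeet : (x : Λ J₀) (covX : Covering J₀ (φ x)) (y : Λ J₀) → IsMeet x y (x ∧⟨ covX ⟩ y)
  ∧-isMeet zero      _    y         = z≤ , z≤ , λ { zero _ _ → z≤ ; (elt _ _) () _ }
  ∧-isMeet (elt E p) _    zero      = z≤ , z≤ , λ { zero _ _ → z≤ ; (elt _ _) _ () }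
  ∧-isMeet (elt E p) covE (elt B q) = ⊆≤ (p∩q⊆p E B) , ⊆≤ (p∩q⊆q E B) , glb
    where
    glb : ∀ z → z ≤Λ elt E p → z ≤Λ elt B q → z ≤Λ elt (E ∩ B) (∩-admissible J₀ compHyp p covE q)
    glb zero      _        _        = z≤
    glb (elt _ _) (⊆≤ C⊆E) (⊆≤ C⊆B) = ⊆≤ (λ x∈C → x∈p∩q⁺ (C⊆E x∈C , C⊆B x∈C))

  ∨-∧-rightModular : (x : Λ J₀) (covX : Covering J₀ (φ x)) (a c : Λ J₀) → c ≤Λ x
                   → (c ∨ (x ∧⟨ covX ⟩ a)) ≈ (x ∧⟨ covX ⟩ (c ∨ a))
  ∨-∧-rightModular x covX a zero _ = ≈-refl
  ∨-∧-rightModular (elt E _) _ zero (elt C _) (⊆≤ C⊆E) =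
    elt-≡ (sym (trans (∩-comm E C) (p⊆q⇒p∩q≡p C⊆E)))
  ∨-∧-rightModular (elt E _) _ (elt A _) (elt C _) (⊆≤ C⊆E) = elt-≡ (begin
    C ∪ (E ∩ A) ≡⟨ cong (C ∪_) (∩-comm E A) ⟩
    C ∪ (A ∩ E) ≡⟨ p⊆r⇒p∪[q∩r]≡[p∪q]∩r C⊆E ⟩
    (C ∪ A) ∩ E ≡⟨ ∩-comm (C ∪ A) E ⟩
    E ∩ (C ∪ A) ∎)
    where open ≡-Reasoning

  ∨-∧-leftModular : (x : Λ J₀) (covX : Covering J₀ (φ x)) (b c : Λ J₀) → c ≤Λ b
                  → (c ∨ (x ∧⟨ covX ⟩ b)) ≈ ((c ∨ x) ∧⟨ ∨-coveringʳ c covX ⟩ b)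
  ∨-∧-leftModular x covX b zero _ = ≈-refl
  ∨-∧-leftModular zero _ (elt B _) (elt C _) (⊆≤ C⊆B) = elt-≡ (sym (p⊆q⇒p∩q≡p C⊆B))
  ∨-∧-leftModular (elt E _) _ (elt B _) (elt C _) (⊆≤ C⊆B) =
    elt-≡ (p⊆r⇒p∪[q∩r]≡[p∪q]∩r C⊆B)

  covering-rightModular : (x : Λ J₀) → Covering J₀ (φ x) → RightModular x
  covering-rightModular x covX a c c≤x =
    modId-from-witnesses (isMeet-flip (∧-isMeet x covX a)) (∨-isJoin c (x ∧⟨ covX ⟩ a))
                         (∨-isJoin c a) (isMeet-flip (∧-isMeet x covX (c ∨ a)))
                         (∨-∧-rightModular x covX a c c≤x)

  covering-leftModular : (x : Λ J₀) → Covering J₀ (φ x) → LeftModular x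
  covering-leftModular x covX b c c≤b =
    modId-from-witnesses (∧-isMeet x covX b) (∨-isJoin c (x ∧⟨ covX ⟩ b))
                         (∨-isJoin c x) (∧-isMeet (c ∨ x) (∨-coveringʳ c covX) b)
                         (∨-∧-leftModular x covX b c c≤b)

mainTheorem12 : (n : ℕ) → 1 ≤ n → (J₀ : Subset n) → (∃ λ α → α ∉ J₀) → CompHyp J₀
    → (e : Λ J₀) → (∀ α → α ∉ J₀ → α ∈ φ e)
    → LatticeNotions.RightModular (_≤Λ_ {n} {J₀}) e × LatticeNotions.LeftModular (_≤Λ_ {n} {J₀}) e
mainTheorem12 n _ J₀ _ compHyp e covE =
  covering-rightModular compHyp e covE , covering-leftModular compHyp e covE
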